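{- For any integers $n_1,n_2$ with $2\le n_1<n_2$, $$\left\lfloor\frac{n_1+n_2-2}{n_1-1}\right\rfloor\le \dim(P_{n_1}\boxtimes P_{n_2})\le\left\lceil\frac{n_1+n_2-2}{n_1-1}\right\rceil.$$
   Context: $P_n$ is the path of order $n$. A set $S\subseteq V(G)$ of a connected graph $G$ is a metric generator if for every two distinct vertices $x,y$ there is $s\in S$ with $d_G(s,x)\ne d_G(s,y)$ (shortest-path distance); $\dim(G)$ is the minimum cardinality of a metric generator. The strong product $G\boxtimes H$ has vertex set $V(G)\times V(H)$, with $(a,b)$ and $(c,d)$ adjacent iff ($a=c$ and $bd\in E(H)$) or ($b=d$ and $ac\in E(G)$) or ($ac\in E(G)$ and $bd\in E(H)$). -}

module Defs where

open import Data.Nat using (ℕ; zero; suc; _+_; _∸_; _≤_; _<_; _/_)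
open import Data.Fin using (Fin; toℕ)
open import Data.Product using (_×_; Σ; ∃; ∃-syntax; _,_)
open import Data.Sum using (_⊎_)
open import Data.List using (List; length)
open import Data.List.Membership.Propositional using (_∈_)
open import Data.List.Relation.Unary.Unique.Propositional using (Unique)
open import Relation.Binary.PropositionalEquality using (_≡_; _≢_)

record Graph (V : Set) : Set₁ where
  field
    Adj : V → V → Set

open Graph public

data Walk {V : Set} (G : Graph V) : ℕ → V → V → Set where
  here : ∀ {x} → Walk G 0 x x
  step : ∀ {k x y z} → Adj G x y → Walk G k y z → Walk G (suc k) x z

IsDist : {V : Set} → Graph V → V → V → ℕ → Set
IsDist G x y k = Walk G k x y × (∀ m → Walk G m x y → k ≤ m)

MetricGenerator : {V : Set} → Graph V → List V → Set
MetricGenerator {V} G S =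
  ∀ (x y : V) → x ≢ y →
    ∃[ s ] (s ∈ S × ∃[ k ] ∃[ l ] (IsDist G s x k × IsDist G s y l × k ≢ l))

-- d is the metric dimension: minimum cardinality of a metric generator
-- (finite sets represented by duplicate-free lists, cardinality = length).
IsMetricDim : {V : Set} → Graph V → ℕ → Set
IsMetricDim {V} G d =
  (∃[ S ] (Unique S × length S ≡ d × MetricGenerator G S))
  × (∀ (S : List V) → Unique S → MetricGenerator G S → d ≤ length S)

Path : (n : ℕ) → Graph (Fin n)
Adj (Path n) i j = suc (toℕ i) ≡ toℕ j ⊎ suc (toℕ j) ≡ toℕ i

_⊠_ : {A B : Set} → Graph A → Graph B → Graph (A × B)
Adj (G ⊠ H) (a , b) (c , d) =
    (a ≡ c × Adj H b d)
  ⊎ (b ≡ d × Adj G a c)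
  ⊎ (Adj G a c × Adj H b d)

-- ⌊ a / (n1 - 1) ⌋ and ⌈ a / (n1 - 1) ⌉ (only used with n1 ≥ 2; junk value 0 otherwise)
floorDivPred : ℕ → ℕ → ℕ
floorDivPred a zero = 0
floorDivPred a (suc zero) = 0
floorDivPred a (suc (suc m)) = a / suc m

ceilDivPred : ℕ → ℕ → ℕ
ceilDivPred a zero = 0
ceilDivPred a (suc zero) = 0
ceilDivPred a (suc (suc m)) = (a + m) / suc m

module Submission where

-- Distances in P_m ⊠ P_n are Chebyshev distances max(|Δ row|, |Δ column|), since a walk in a
-- strong product projects onto walks in both factors and two walks can be run simultaneously.
--
-- Lower bound (m = k + 2): a landmark (a, b) separates the ends of the vertical edge between rows
-- r and r + 1 in column j only if |b - j| is at most the distance from a to that edge. The two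
-- distances from a to the edges {0, 1} and {k, k + 1} add up to at most k, so every landmark
-- separates at most 2(k + 1) of the 2n pairs formed by these two edges in the n columns, hence
-- n ≤ |S| (m - 1).
--
-- Upper bound (H = m - 1): landmarks in columns 0, H, 2H, … (the last one capped at n - 1),
-- alternately on the top and the bottom row. Two vertices in one column are separated by the top
-- or the bottom landmark of the consecutive pair enclosing that column, whose horizontal offsets
-- add up to at most H; two vertices in different columns are separated by one of the first
-- three landmarks (0, 0), (H, H), (0, min(2H, n - 1)).
--
-- The metric dimension exists at all because resolving sets of a given size can be searched for
-- exhaustively in a finite graph.

open import Defs
open import Data.Bool using (Bool; true; false; not)
open import Data.Fin using (Fin; zero; suc; toℕ; fromℕ; fromℕ<; inject₁)
open import Data.Fin.Properties using (toℕ-injective; toℕ<n; toℕ-fromℕ; toℕ-fromℕ<; toℕ-inject₁)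
import Data.Fin.Properties as Fin
open import Data.List using (List; []; _∷_; length; lookup; deduplicate; applyUpTo)
open import Data.List.Properties using (length-deduplicate; length-applyUpTo)
open import Data.List.Membership.Propositional using (_∈_; find; lose)
open import Data.List.Membership.Propositional.Properties using (∈-deduplicate⁺; ∈-applyUpTo⁺)
open import Data.List.Relation.Binary.Subset.Propositional using (_⊆_)
open import Data.List.Relation.Unary.Any using (Any)
import Data.List.Relation.Unary.Any as Any
open import Data.List.Relation.Unary.Any.Properties using (lookup-index)
open import Data.List.Relation.Unary.Unique.Propositional using (Unique)
open import Data.List.Relation.Unary.Unique.DecPropositional using (unique?)
open import Data.List.Relation.Unary.Unique.DecPropositional.Properties using (deduplicate-!)
open import Data.Nat
  using (ℕ; zero; suc; _+_; _*_; _∸_; _≤_; _<_; _⊔_; _⊓_; ∣_-_∣; z≤n; s≤s; s≤s⁻¹; z<s; pred; _/_; _%_;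
         NonZero; >-nonZero)
import Data.Nat as ℕ
open import Data.Nat.DivMod using (m<n*o⇒m/o<n; m≡m%n+[m/n]*n; m%n<n; m/n≡1+[m∸n]/n; m/n*n≤m)
open import Data.Nat.Induction using (<-rec)
open import Data.Nat.Properties
open import Algebra.Properties.CommutativeMonoid.Sum +-0-commutativeMonoid using (sum-syntax; ∑-comm; ∑-distrib-+)
open import Data.Nat.Tactic.RingSolver using (solve-∀)
open import Data.Product using (_×_; ∃; ∃-syntax; _,_; proj₁; proj₂)
open import Data.Product.Properties using (≡-dec)
open import Data.Sum using (_⊎_; inj₁; inj₂; swap)
open import Function using (_∘_)
open import Relation.Binary using (DecidableEquality; tri<; tri≈; tri>)
open import Relation.Binary.PropositionalEquality
open import Relation.Nullary using (Dec; yes; no; ¬?; contradiction)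
open import Relation.Nullary.Decidable using (map′; _×-dec_; _→-dec_; decidable-stable)
open import Relation.Unary using (Decidable)

module _ {V : Set} {G : Graph V} where

  snoc : ∀ {k x y z} → Walk G k x y → Adj G y z → Walk G (suc k) x z
  snoc here         e = step e here
  snoc (step e′ w)  e = step e′ (snoc w e)

  reverse : (∀ {x y} → Adj G x y → Adj G y x) → ∀ {k x y} → Walk G k x y → Walk G k y x
  reverse sym-adj here       = here
  reverse sym-adj (step e w) = snoc (reverse sym-adj w) (sym-adj e)

  walk-potential-bound : (f : V → ℕ) → (∀ {x y} → Adj G x y → f x ≤ suc (f y)) →
                   ∀ {k x y} → Walk G k x y → f x ≤ k + f y
  walk-potential-bound f lipschitz here       = ≤-refl
  walk-potential-bound f lipschitz (step e w) = ≤-trans (lipschitz e) (s≤s (walk-potential-bound f lipschitz w))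

  IsDist-unique : ∀ {x y k l} → IsDist G x y k → IsDist G x y l → k ≡ l
  IsDist-unique (walk-k , min-k) (walk-l , min-l) = ≤-antisym (min-k _ walk-l) (min-l _ walk-k)

module _ {A B : Set} {G : Graph A} {H : Graph B} where

  ⊠-liftˡ : ∀ {k a c b} → Walk G k a c → Walk (G ⊠ H) k (a , b) (c , b)
  ⊠-liftˡ here       = here
  ⊠-liftˡ (step e w) = step (inj₂ (inj₁ (refl , e))) (⊠-liftˡ w)

  ⊠-liftʳ : ∀ {l a b d} → Walk H l b d → Walk (G ⊠ H) l (a , b) (a , d)
  ⊠-liftʳ here       = here
  ⊠-liftʳ (step e w) = step (inj₁ (refl , e)) (⊠-liftʳ w)

  ⊠-zip : ∀ {k l a b c d} → Walk G k a c → Walk H l b d → Walk (G ⊠ H) (k ⊔ l) (a , b) (c , d)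
  ⊠-zip here         v            = ⊠-liftʳ v
  ⊠-zip w@(step _ _) here         = ⊠-liftˡ w
  ⊠-zip (step e w)   (step e′ v)  = step (inj₂ (inj₂ (e , e′))) (⊠-zip w v)

  ⊠-projˡ : ∀ {m x y} → Walk (G ⊠ H) m x y → ∃[ k ] (k ≤ m × Walk G k (proj₁ x) (proj₁ y))
  ⊠-projˡ here = 0 , z≤n , here
  ⊠-projˡ (step (inj₁ (refl , _)) w) with ⊠-projˡ w
  ... | k , k≤m , v = k , m≤n⇒m≤1+n k≤m , v
  ⊠-projˡ (step (inj₂ (inj₁ (_ , e))) w) with ⊠-projˡ w
  ... | k , k≤m , v = suc k , s≤s k≤m , step e v
  ⊠-projˡ (step (inj₂ (inj₂ (e , _))) w) with ⊠-projˡ w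
  ... | k , k≤m , v = suc k , s≤s k≤m , step e v

  ⊠-projʳ : ∀ {m x y} → Walk (G ⊠ H) m x y → ∃[ l ] (l ≤ m × Walk H l (proj₂ x) (proj₂ y))
  ⊠-projʳ here = 0 , z≤n , here
  ⊠-projʳ (step (inj₁ (_ , e)) w) with ⊠-projʳ w
  ... | l , l≤m , v = suc l , s≤s l≤m , step e v
  ⊠-projʳ (step (inj₂ (inj₁ (refl , _))) w) with ⊠-projʳ w
  ... | l , l≤m , v = l , m≤n⇒m≤1+n l≤m , v
  ⊠-projʳ (step (inj₂ (inj₂ (_ , e))) w) with ⊠-projʳ w
  ... | l , l≤m , v = suc l , s≤s l≤m , step e v

  ⊠-IsDist : ∀ {a b c d k l} → IsDist G a c k → IsDist H b d l →
             IsDist (G ⊠ H) (a , b) (c , d) (k ⊔ l)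
  ⊠-IsDist {a} {b} {c} {d} {k} {l} (w , min-G) (v , min-H) = ⊠-zip w v , shortest
    where
    shortest : ∀ m → Walk (G ⊠ H) m (a , b) (c , d) → k ⊔ l ≤ m
    shortest m u with ⊠-projˡ u | ⊠-projʳ u
    ... | k′ , k′≤m , w′ | l′ , l′≤m , v′ = ⊔-lub (≤-trans (min-G k′ w′) k′≤m) (≤-trans (min-H l′ v′) l′≤m)

module _ {n : ℕ} where

  Path-sym : ∀ {i j : Fin n} → Adj (Path n) i j → Adj (Path n) j i
  Path-sym = swap

  Path-adj⇒∣-∣≡1 : ∀ {i j : Fin n} → Adj (Path n) i j → ∣ toℕ i - toℕ j ∣ ≡ 1
  Path-adj⇒∣-∣≡1 {i} (inj₁ e) rewrite sym e =
    trans (m≤n⇒∣m-n∣≡n∸m (n≤1+n (toℕ i))) (m+n∸n≡m 1 (toℕ i))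
  Path-adj⇒∣-∣≡1 {j = j} (inj₂ e) rewrite sym e =
    trans (m≤n⇒∣n-m∣≡n∸m (n≤1+n (toℕ j))) (m+n∸n≡m 1 (toℕ j))

  Path-ascending : ∀ d (i j : Fin n) → toℕ j ≡ d + toℕ i → Walk (Path n) d i j
  Path-ascending zero    i j j≡i = subst (Walk (Path n) 0 i) (toℕ-injective (sym j≡i)) here
  Path-ascending (suc d) i j j≡ = step (inj₁ (sym (toℕ-fromℕ< i+1<n))) (Path-ascending d _ j j≡′)
    where
    i+1<n : suc (toℕ i) < n
    i+1<n = ≤-<-trans (subst (suc (toℕ i) ≤_) (sym j≡) (s≤s (m≤n+m (toℕ i) d))) (toℕ<n j)
    j≡′ : toℕ j ≡ d + toℕ (fromℕ< i+1<n)
    j≡′ = trans j≡ (trans (sym (+-suc d (toℕ i))) (cong (d +_) (sym (toℕ-fromℕ< i+1<n))))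

  Path-IsDist : ∀ (i j : Fin n) → IsDist (Path n) i j ∣ toℕ i - toℕ j ∣
  Path-IsDist i j = walk (≤-total (toℕ i) (toℕ j)) , shortest
    where
    walk : (toℕ i ≤ toℕ j) ⊎ (toℕ j ≤ toℕ i) → Walk (Path n) ∣ toℕ i - toℕ j ∣ i j
    walk (inj₁ i≤j) = subst (λ d → Walk (Path n) d i j) (sym (m≤n⇒∣m-n∣≡n∸m i≤j))
      (Path-ascending _ i j (sym (m∸n+n≡m i≤j)))
    walk (inj₂ j≤i) = subst (λ d → Walk (Path n) d i j) (sym (m≤n⇒∣n-m∣≡n∸m j≤i))
      (reverse Path-sym (Path-ascending _ j i (sym (m∸n+n≡m j≤i))))
    shortest : ∀ m → Walk (Path n) m i j → ∣ toℕ i - toℕ j ∣ ≤ m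
    shortest m w = subst (∣ toℕ i - toℕ j ∣ ≤_) (trans (cong (m +_) (∣n-n∣≡0 (toℕ j))) (+-identityʳ m))
      (walk-potential-bound (λ v → ∣ toℕ v - toℕ j ∣) lipschitz w)
      where
      lipschitz : ∀ {x y} → Adj (Path n) x y → ∣ toℕ x - toℕ j ∣ ≤ suc ∣ toℕ y - toℕ j ∣
      lipschitz {x} {y} e = subst (λ d → ∣ toℕ x - toℕ j ∣ ≤ d + ∣ toℕ y - toℕ j ∣) (Path-adj⇒∣-∣≡1 e)
        (∣-∣-triangle (toℕ x) (toℕ y) (toℕ j))

dist : ∀ {m n} → Fin m × Fin n → Fin m × Fin n → ℕ
dist (a , b) (c , d) = ∣ toℕ a - toℕ c ∣ ⊔ ∣ toℕ b - toℕ d ∣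

grid-IsDist : ∀ {m n} (x y : Fin m × Fin n) → IsDist (Path m ⊠ Path n) x y (dist x y)
grid-IsDist (a , b) (c , d) = ⊠-IsDist (Path-IsDist a c) (Path-IsDist b d)

Resolves : {V : Set} → (V → V → ℕ) → List V → Set
Resolves {V} d S = ∀ (x y : V) → x ≢ y → Any (λ s → d s x ≢ d s y) S

module _ {V : Set} {G : Graph V} where

  MetricGenerator-⊆ : ∀ {S T : List V} → S ⊆ T → MetricGenerator G S → MetricGenerator G T
  MetricGenerator-⊆ S⊆T gen x y x≢y with gen x y x≢y
  ... | s , s∈S , separation = s , S⊆T s∈S , separation

  module _ {d : V → V → ℕ} (isDist : ∀ x y → IsDist G x y (d x y)) where

    MetricGenerator⇒Resolves : ∀ {S} → MetricGenerator G S → Resolves d S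
    MetricGenerator⇒Resolves gen x y x≢y with gen x y x≢y
    ... | s , s∈S , k , l , dist-k , dist-l , k≢l =
      lose s∈S (λ eq → k≢l (trans (IsDist-unique dist-k (isDist s x))
                                  (trans eq (IsDist-unique (isDist s y) dist-l))))

    Resolves⇒MetricGenerator : ∀ {S} → Resolves d S → MetricGenerator G S
    Resolves⇒MetricGenerator res x y x≢y with find (res x y x≢y)
    ... | s , s∈S , separation = s , s∈S , d s x , d s y , isDist s x , isDist s y , separation

Least : (ℕ → Set) → ℕ → Set
Least P m = P m × ∀ j → P j → m ≤ j

least-witness : ∀ {P : ℕ → Set} → Decidable P → ∀ {n} → P n → ∃[ m ] Least P m
least-witness {P} P? {n} = <-rec (λ n → P n → ∃[ m ] Least P m) search n
  where
  search : ∀ n → (∀ {j} → j < n → P j → ∃[ m ] Least P m) → P n → ∃[ m ] Least P m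
  search n smaller pn with anyUpTo? P? n
  ... | yes (j , j<n , pj) = smaller j<n pj
  ... | no none            = n , pn , λ j pj → ≮⇒≥ (λ j<n → none (j , j<n , pj))

module MetricDimension {V : Set} (_≟_ : DecidableEquality V)
  (any? : ∀ {P : V → Set} → Decidable P → Dec (∃ P))
  (G : Graph V) (d : V → V → ℕ) (isDist : ∀ x y → IsDist G x y (d x y)) where

  all? : ∀ {P : V → Set} → Decidable P → Dec (∀ x → P x)
  all? P? with any? (¬? ∘ P?)
  ... | yes (x , ¬px) = no (λ all → ¬px (all x))
  ... | no  ∄¬p       = yes (λ x → decidable-stable (P? x) (λ ¬px → ∄¬p (x , ¬px)))

  ∃-ofLength? : ∀ {Q : List V → Set} → Decidable Q → ∀ k → Dec (∃[ S ] (length S ≡ k × Q S))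
  ∃-ofLength? Q? zero = map′ (λ q → [] , refl , q) (λ { ([] , _ , q) → q }) (Q? [])
  ∃-ofLength? Q? (suc k) =
    map′ (λ { (x , S , |S|≡k , q) → x ∷ S , cong suc |S|≡k , q })
         (λ { (x ∷ S , |S|≡1+k , q) → x , S , suc-injective |S|≡1+k , q })
         (any? (λ x → ∃-ofLength? (Q? ∘ (x ∷_)) k))

  resolves? : Decidable (Resolves d)
  resolves? S = all? λ x → all? λ y → ¬? (x ≟ y) →-dec Any.any? (λ s → ¬? (d s x ℕ.≟ d s y)) S

  GeneratorOfSize : ℕ → Set
  GeneratorOfSize k = ∃[ S ] (Unique S × length S ≡ k × MetricGenerator G S)

  generatorOfSize? : Decidable GeneratorOfSize
  generatorOfSize? k =
    map′ (λ { (S , |S|≡k , unique , res) → S , unique , |S|≡k , Resolves⇒MetricGenerator isDist res })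
         (λ { (S , unique , |S|≡k , gen) → S , |S|≡k , unique , MetricGenerator⇒Resolves isDist gen })
         (∃-ofLength? (λ S → unique? _≟_ S ×-dec resolves? S) k)

  deduplicated-generator : ∀ L → MetricGenerator G L → GeneratorOfSize (length (deduplicate _≟_ L))
  deduplicated-generator L gen = deduplicate _≟_ L , deduplicate-! _≟_ L , refl ,
                                 MetricGenerator-⊆ (∈-deduplicate⁺ _≟_) gen

  metricDim≤ : ∀ L → MetricGenerator G L → ∃[ m ] (IsMetricDim G m × m ≤ length L)
  metricDim≤ L gen with least-witness generatorOfSize? (deduplicated-generator L gen)
  ... | m , witness , least =
    m , (witness , λ S unique gen′ → least _ (S , unique , refl , gen′)) ,
    ≤-trans (least _ (deduplicated-generator L gen)) (length-deduplicate _≟_ L)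

𝟙 : ∀ {A : Set} → Dec A → ℕ
𝟙 (yes _) = 1
𝟙 (no _)  = 0

𝟙≤1 : ∀ {A : Set} (a? : Dec A) → 𝟙 a? ≤ 1
𝟙≤1 (yes _) = ≤-refl
𝟙≤1 (no _)  = z≤n

𝟙-mono : ∀ {A B : Set} (a? : Dec A) (b? : Dec B) → (A → B) → 𝟙 a? ≤ 𝟙 b?
𝟙-mono (yes _) (yes _) _   = ≤-refl
𝟙-mono (yes a) (no ¬b) a→b = contradiction (a→b a) ¬b
𝟙-mono (no _)  _       _   = z≤n

𝟙-yes : ∀ {A : Set} (a? : Dec A) → A → 𝟙 a? ≡ 1
𝟙-yes (yes _) _ = refl
𝟙-yes (no ¬a) a = contradiction a ¬a

∑-mono-≤ : ∀ {n} {f g : Fin n → ℕ} → (∀ i → f i ≤ g i) → ∑[ i < n ] f i ≤ ∑[ i < n ] g i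
∑-mono-≤ {zero}  f≤g = z≤n
∑-mono-≤ {suc n} f≤g = +-mono-≤ (f≤g zero) (∑-mono-≤ (f≤g ∘ suc))

∑-const : ∀ n c → ∑[ i < n ] c ≡ n * c
∑-const zero    c = refl
∑-const (suc n) c = cong (c +_) (∑-const n c)

term≤∑ : ∀ {n} (f : Fin n → ℕ) i → f i ≤ ∑[ j < n ] f j
term≤∑ f zero    = m≤m+n (f zero) _
term≤∑ f (suc i) = ≤-trans (term≤∑ (f ∘ suc) i) (m≤n+m _ (f zero))

Any⇒1≤∑𝟙 : ∀ {A : Set} {P : A → Set} (P? : Decidable P) {xs : List A} →
           Any P xs → 1 ≤ ∑[ i < length xs ] 𝟙 (P? (lookup xs i))
Any⇒1≤∑𝟙 P? {xs} p = subst (_≤ _) (𝟙-yes (P? (lookup xs (Any.index p))) (lookup-index p))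
                            (term≤∑ (λ i → 𝟙 (P? (lookup xs i))) (Any.index p))

count-in-interval : ∀ {Q : ℕ → Set} (Q? : Decidable Q) {lo w} →
                    (∀ {j} → Q j → lo ≤ j × j < lo + w) → ∀ n → ∑[ j < n ] 𝟙 (Q? (toℕ j)) ≤ w
count-in-interval Q? inside zero = z≤n
count-in-interval Q? {suc lo} inside (suc n) with Q? 0
... | yes q = contradiction (proj₁ (inside q)) λ ()
... | no _  = count-in-interval (Q? ∘ suc) (λ q → let lo≤j , j<hi = inside q in s≤s⁻¹ lo≤j , s≤s⁻¹ j<hi) n
count-in-interval Q? {zero} {zero} inside (suc n) with Q? 0
... | yes q = contradiction (proj₂ (inside q)) n≮0
... | no _  = count-in-interval (Q? ∘ suc) {0} {0} (λ q → contradiction (proj₂ (inside q)) n≮0) n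
count-in-interval Q? {zero} {suc w} inside (suc n) =
  +-mono-≤ (𝟙≤1 (Q? 0)) (count-in-interval (Q? ∘ suc) (λ q → z≤n , s≤s⁻¹ (proj₂ (inside q))) n)

∣-∣≤⇒interval : ∀ b j P → ∣ b - j ∣ ≤ P → b ∸ P ≤ j × j < b ∸ P + suc (P + P)
∣-∣≤⇒interval b j P ∣b-j∣≤P = lower , upper
  where
  lower : b ∸ P ≤ j
  lower = m≤n+o⇒m∸n≤o b P (begin
    b             ≤⟨ m≤n+∣m-n∣ b j ⟩
    j + ∣ b - j ∣ ≤⟨ +-monoʳ-≤ j ∣b-j∣≤P ⟩
    j + P         ≡⟨ +-comm j P ⟩
    P + j         ∎)
    where open ≤-Reasoning
  upper : j < b ∸ P + suc (P + P)
  upper = begin-strict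
    j                     ≤⟨ m≤n+∣n-m∣ j b ⟩
    b + ∣ b - j ∣         ≤⟨ +-monoʳ-≤ b ∣b-j∣≤P ⟩
    b + P                 ≤⟨ +-monoˡ-≤ P (m≤n+m∸n b P) ⟩
    P + (b ∸ P) + P       ≡⟨ cong (_+ P) (+-comm P (b ∸ P)) ⟩
    b ∸ P + P + P         ≡⟨ +-assoc (b ∸ P) P P ⟩
    b ∸ P + (P + P)       <⟨ n<1+n _ ⟩
    suc (b ∸ P + (P + P)) ≡⟨ +-suc (b ∸ P) (P + P) ⟨
    b ∸ P + suc (P + P)   ∎
    where open ≤-Reasoning

m⊔o≢n⊔o⇒o<m⊔n : ∀ {m n o} → m ⊔ o ≢ n ⊔ o → o < m ⊔ n
m⊔o≢n⊔o⇒o<m⊔n {m} {n} separated = ≰⇒> λ m⊔n≤o →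
  separated (trans (m≤n⇒m⊔n≡n (m⊔n≤o⇒m≤o m n m⊔n≤o)) (sym (m≤n⇒m⊔n≡n (m⊔n≤o⇒n≤o m n m⊔n≤o))))

distToEdge : ℕ → ℕ → ℕ
distToEdge a r = (r ∸ a) ⊔ (a ∸ suc r)

∣-∣⊔∣-∣≡1+distToEdge : ∀ a r → ∣ a - r ∣ ⊔ ∣ a - suc r ∣ ≡ suc (distToEdge a r)
∣-∣⊔∣-∣≡1+distToEdge zero    r       = trans (m≤n⇒m⊔n≡n (n≤1+n r)) (cong suc (sym (⊔-identityʳ r)))
∣-∣⊔∣-∣≡1+distToEdge (suc a) zero    = trans (cong (suc a ⊔_) (∣-∣-identityʳ a)) (m≥n⇒m⊔n≡m (n≤1+n a))
∣-∣⊔∣-∣≡1+distToEdge (suc a) (suc r) = ∣-∣⊔∣-∣≡1+distToEdge a r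

distToEdge-first+last : ∀ {a k} → a ≤ suc k → distToEdge a 0 + distToEdge a k ≤ k
distToEdge-first+last {zero}  {k} _         = ≤-reflexive (⊔-identityʳ k)
distToEdge-first+last {suc a} {k} (s≤s a≤k) = begin
  a + ((k ∸ suc a) ⊔ (a ∸ k)) ≡⟨ cong (λ t → a + ((k ∸ suc a) ⊔ t)) (m≤n⇒m∸n≡0 a≤k) ⟩
  a + ((k ∸ suc a) ⊔ 0)       ≡⟨ cong (a +_) (⊔-identityʳ (k ∸ suc a)) ⟩
  a + (k ∸ suc a)             ≤⟨ +-monoʳ-≤ a (∸-monoʳ-≤ k (n≤1+n a)) ⟩
  a + (k ∸ a)                 ≡⟨ m+[n∸m]≡n a≤k ⟩
  k                           ∎
  where open ≤-Reasoning

module _ {k n : ℕ} where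

  edge-ends-distinct : ∀ (r : Fin (suc k)) (j : Fin n) → (inject₁ r , j) ≢ (suc r , j)
  edge-ends-distinct r j eq = 1+n≢n (trans (sym (cong (toℕ ∘ proj₁) eq)) (toℕ-inject₁ r))

  separatesEdge? : (s : Fin (suc (suc k)) × Fin n) (r : Fin (suc k)) (j : Fin n) →
                   Dec (dist s (inject₁ r , j) ≢ dist s (suc r , j))
  separatesEdge? s r j = ¬? (dist s (inject₁ r , j) ℕ.≟ dist s (suc r , j))

  edge-separator-nearby : ∀ (a : Fin (suc (suc k))) (b : Fin n) r j →
                          dist (a , b) (inject₁ r , j) ≢ dist (a , b) (suc r , j) →
                          ∣ toℕ b - toℕ j ∣ ≤ distToEdge (toℕ a) (toℕ r)
  edge-separator-nearby a b r j separated =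
    s≤s⁻¹ (subst (∣ toℕ b - toℕ j ∣ <_) (∣-∣⊔∣-∣≡1+distToEdge (toℕ a) (toℕ r))
                 (m⊔o≢n⊔o⇒o<m⊔n (subst (λ t → ∣ toℕ a - t ∣ ⊔ e ≢ ∣ toℕ a - suc (toℕ r) ∣ ⊔ e)
                                         (toℕ-inject₁ r) separated)))
    where e = ∣ toℕ b - toℕ j ∣

  edge-separations≤ : ∀ (a : Fin (suc (suc k))) (b : Fin n) r →
    ∑[ j < n ] 𝟙 (separatesEdge? (a , b) r j) ≤ suc (distToEdge (toℕ a) (toℕ r) + distToEdge (toℕ a) (toℕ r))
  edge-separations≤ a b r =
    ≤-trans (∑-mono-≤ λ j → 𝟙-mono (separatesEdge? (a , b) r j) (near? (toℕ j)) (edge-separator-nearby a b r j))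
            (count-in-interval near? (λ {j} → ∣-∣≤⇒interval (toℕ b) j _) n)
    where
    near? : Decidable (λ v → ∣ toℕ b - v ∣ ≤ distToEdge (toℕ a) (toℕ r))
    near? v = ∣ toℕ b - v ∣ ℕ.≤? distToEdge (toℕ a) (toℕ r)

  separations : Fin (suc (suc k)) × Fin n → Fin n → ℕ
  separations s j = 𝟙 (separatesEdge? s zero j) + 𝟙 (separatesEdge? s (fromℕ k) j)

  separations≤ : ∀ s → ∑[ j < n ] separations s j ≤ 2 * suc k
  separations≤ (a , b) = begin
    ∑[ j < n ] separations (a , b) j ≡⟨ ∑-distrib-+ (λ j → 𝟙 (separatesEdge? (a , b) zero j)) _ ⟩
    ∑[ j < n ] 𝟙 (separatesEdge? (a , b) zero j) + ∑[ j < n ] 𝟙 (separatesEdge? (a , b) (fromℕ k) j)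
                                     ≤⟨ +-mono-≤ (edge-separations≤ a b zero) (edge-separations≤ a b (fromℕ k)) ⟩
    suc (x + x) + suc (y + y)        ≡⟨ collect x y ⟩
    2 * suc (x + y)                  ≤⟨ *-monoʳ-≤ 2 (s≤s x+y≤k) ⟩
    2 * suc k                        ∎
    where
    open ≤-Reasoning
    x = distToEdge (toℕ a) 0
    y = distToEdge (toℕ a) (toℕ (fromℕ k))
    x+y≤k : x + y ≤ k
    x+y≤k = subst (λ t → x + distToEdge (toℕ a) t ≤ k) (sym (toℕ-fromℕ k))
                  (distToEdge-first+last (s≤s⁻¹ (toℕ<n a)))
    collect : ∀ x y → suc (x + x) + suc (y + y) ≡ 2 * suc (x + y)
    collect = solve-∀

  resolving⇒n≤|S|*[1+k] : ∀ (S : List (Fin (suc (suc k)) × Fin n)) → Resolves dist S → n ≤ length S * suc k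
  resolving⇒n≤|S|*[1+k] S res = *-cancelˡ-≤ 2 (begin
    2 * n                                                   ≡⟨ *-comm 2 n ⟩
    n * 2                                                   ≡⟨ ∑-const n 2 ⟨
    ∑[ j < n ] 2                                            ≤⟨ ∑-mono-≤ two-separations ⟩
    ∑[ j < n ] ∑[ i < length S ] separations (lookup S i) j ≡⟨ ∑-comm (λ j i → separations (lookup S i) j) ⟩
    ∑[ i < length S ] ∑[ j < n ] separations (lookup S i) j ≤⟨ ∑-mono-≤ (λ i → separations≤ (lookup S i)) ⟩
    ∑[ i < length S ] (2 * suc k)                           ≡⟨ ∑-const (length S) (2 * suc k) ⟩
    length S * (2 * suc k)                                  ≡⟨ reassociate (length S) (suc k) ⟩
    2 * (length S * suc k)                                  ∎)
    where
    open ≤-Reasoning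
    resolved : ∀ r j → 1 ≤ ∑[ i < length S ] 𝟙 (separatesEdge? (lookup S i) r j)
    resolved r j = Any⇒1≤∑𝟙 (λ s → separatesEdge? s r j) (res _ _ (edge-ends-distinct r j))
    two-separations : ∀ j → 2 ≤ ∑[ i < length S ] separations (lookup S i) j
    two-separations j = subst (2 ≤_) (sym (∑-distrib-+ (λ i → 𝟙 (separatesEdge? (lookup S i) zero j)) _))
                              (+-mono-≤ (resolved zero j) (resolved (fromℕ k) j))
    reassociate : ∀ x y → x * (2 * y) ≡ 2 * (x * y)
    reassociate = solve-∀

  resolving⇒[k+n]/[1+k]≤|S| : ∀ (S : List (Fin (suc (suc k)) × Fin n)) → Resolves dist S → (k + n) / suc k ≤ length S
  resolving⇒[k+n]/[1+k]≤|S| S res = s≤s⁻¹ (m<n*o⇒m/o<n (s≤s (+-monoʳ-≤ k (resolving⇒n≤|S|*[1+k] S res))))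

m<n⇒o<n⇒m⊔o≢n⊔o : ∀ {m n o} → m < n → o < n → m ⊔ o ≢ n ⊔ o
m<n⇒o<n⇒m⊔o≢n⊔o m<n o<n eq = <-irrefl (trans eq (m≥n⇒m⊔n≡m (<⇒≤ o<n))) (⊔-lub m<n o<n)

n≤m⊔o⇒o<n⇒n≤m : ∀ {m n o} → n ≤ m ⊔ o → o < n → n ≤ m
n≤m⊔o⇒o<n⇒n≤m {m} {n} {o} n≤m⊔o o<n with ⊔-sel m o
... | inj₁ m⊔o≡m = subst (n ≤_) m⊔o≡m n≤m⊔o
... | inj₂ m⊔o≡o = contradiction (subst (n ≤_) m⊔o≡o n≤m⊔o) (<⇒≱ o<n)

row-separation : ∀ {H x y eT eB} → x < y → y ≤ H → eT + eB ≤ H →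
                 (x ⊔ eT ≢ y ⊔ eT) ⊎ ((H ∸ x) ⊔ eB ≢ (H ∸ y) ⊔ eB)
row-separation {H} {x} {y} {eT} {eB} x<y y≤H eT+eB≤H with eT <? y
... | yes eT<y = inj₁ (m<n⇒o<n⇒m⊔o≢n⊔o x<y eT<y)
... | no  eT≮y = inj₂ (≢-sym (m<n⇒o<n⇒m⊔o≢n⊔o (∸-monoʳ-< x<y y≤H) eB<H∸x))
  where
  eB<H∸x : eB < H ∸ x
  eB<H∸x = begin-strict
    eB     ≤⟨ m+n≤o⇒m≤o∸n eB (subst (_≤ H) (+-comm eT eB) eT+eB≤H) ⟩
    H ∸ eT ≤⟨ ∸-monoʳ-≤ H (≮⇒≥ eT≮y) ⟩
    H ∸ y  <⟨ ∸-monoʳ-< x<y y≤H ⟩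
    H ∸ x  ∎
    where open ≤-Reasoning

corner-distances⇒transposed : ∀ {H x₁ x₂ y₁ y₂} → x₁ ≤ H → y₁ ≤ H → x₂ < y₂ →
  x₁ ⊔ x₂ ≡ y₁ ⊔ y₂ → ∣ H - x₁ ∣ ⊔ ∣ H - x₂ ∣ ≡ ∣ H - y₁ ∣ ⊔ ∣ H - y₂ ∣ →
  x₂ < x₁ × y₁ ≡ x₂ × y₂ ≡ x₁
corner-distances⇒transposed {H} {x₁} {x₂} {y₁} {y₂} x₁≤H y₁≤H x₂<y₂ from-origin from-corner =
  x₂<x₁ , y₁≡x₂ , y₂≡x₁
  where
  open ≡-Reasoning
  y₂≤x₁ : y₂ ≤ x₁
  y₂≤x₁ = n≤m⊔o⇒o<n⇒n≤m (subst (y₂ ≤_) (sym from-origin) (m≤n⊔m y₁ y₂)) x₂<y₂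
  x₂<x₁ : x₂ < x₁
  x₂<x₁ = <-≤-trans x₂<y₂ y₂≤x₁
  y₂≤H : y₂ ≤ H
  y₂≤H = ≤-trans y₂≤x₁ x₁≤H
  x₂≤H : x₂ ≤ H
  x₂≤H = ≤-trans (<⇒≤ x₂<x₁) x₁≤H
  from-corner′ : (H ∸ y₁) ⊔ (H ∸ y₂) ≡ H ∸ x₂
  from-corner′ = begin
    (H ∸ y₁) ⊔ (H ∸ y₂)     ≡⟨ cong₂ _⊔_ (m≤n⇒∣n-m∣≡n∸m y₁≤H) (m≤n⇒∣n-m∣≡n∸m y₂≤H) ⟨
    ∣ H - y₁ ∣ ⊔ ∣ H - y₂ ∣ ≡⟨ from-corner ⟨
    ∣ H - x₁ ∣ ⊔ ∣ H - x₂ ∣ ≡⟨ cong₂ _⊔_ (m≤n⇒∣n-m∣≡n∸m x₁≤H) (m≤n⇒∣n-m∣≡n∸m x₂≤H) ⟩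
    (H ∸ x₁) ⊔ (H ∸ x₂)     ≡⟨ m≤n⇒m⊔n≡n (∸-monoʳ-≤ H (<⇒≤ x₂<x₁)) ⟩
    H ∸ x₂                  ∎
  y₁≡x₂ : y₁ ≡ x₂
  y₁≡x₂ = ∸-cancelˡ-≡ y₁≤H x₂≤H (≤-antisym
    (subst (H ∸ y₁ ≤_) from-corner′ (m≤m⊔n (H ∸ y₁) (H ∸ y₂)))
    (n≤m⊔o⇒o<n⇒n≤m (≤-reflexive (sym from-corner′)) (∸-monoʳ-< x₂<y₂ y₂≤H)))
  y₂≡x₁ : y₂ ≡ x₁
  y₂≡x₁ = begin
    y₂      ≡⟨ m≤n⇒m⊔n≡n (<⇒≤ x₂<y₂) ⟨
    x₂ ⊔ y₂ ≡⟨ cong (_⊔ y₂) y₁≡x₂ ⟨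
    y₁ ⊔ y₂ ≡⟨ from-origin ⟨
    x₁ ⊔ x₂ ≡⟨ m≥n⇒m⊔n≡m (<⇒≤ x₂<x₁) ⟩
    x₁      ∎

transposed-separated : ∀ {c x₁ x₂} → x₂ < x₁ → x₁ < c → x₁ ⊔ ∣ c - x₂ ∣ ≢ x₂ ⊔ ∣ c - x₁ ∣
transposed-separated {c} {x₁} {x₂} x₂<x₁ x₁<c =
  subst₂ (λ d₂ d₁ → x₁ ⊔ d₂ ≢ x₂ ⊔ d₁) (sym (m≤n⇒∣n-m∣≡n∸m x₂≤c)) (sym (m≤n⇒∣n-m∣≡n∸m (<⇒≤ x₁<c)))
    (>⇒≢ (⊔-lub (<-≤-trans x₂<x₁ (m≤m⊔n x₁ (c ∸ x₂)))
                (<-≤-trans (∸-monoʳ-< x₂<x₁ (<⇒≤ x₁<c)) (m≤n⊔m x₁ (c ∸ x₂)))))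
  where
  x₂≤c : x₂ ≤ c
  x₂≤c = <⇒≤ (<-trans x₂<x₁ x₁<c)

∣-∣+∣-∣≤span : ∀ {a v b H} → a ≤ v → v ≤ b → b ≤ H + a → ∣ a - v ∣ + ∣ b - v ∣ ≤ H
∣-∣+∣-∣≤span {a} {v} {b} {H} a≤v v≤b b≤H+a = begin
  ∣ a - v ∣ + ∣ b - v ∣ ≡⟨ cong₂ _+_ (m≤n⇒∣m-n∣≡n∸m a≤v) (m≤n⇒∣n-m∣≡n∸m v≤b) ⟩
  (v ∸ a) + (b ∸ v)     ≡⟨ +-∸-comm (b ∸ v) a≤v ⟨
  (v + (b ∸ v)) ∸ a     ≡⟨ cong (_∸ a) (m+[n∸m]≡n v≤b) ⟩
  b ∸ a                 ≤⟨ m≤n+o⇒m∸n≤o b a (subst (b ≤_) (+-comm H a) b≤H+a) ⟩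
  H                     ∎
  where open ≤-Reasoning

module _ {H n : ℕ} {L : List (Fin (suc H) × Fin n)} where

  dist-from-bottom : ∀ (c : Fin n) (x : Fin (suc H) × Fin n) →
                     dist (fromℕ H , c) x ≡ (H ∸ toℕ (proj₁ x)) ⊔ ∣ toℕ c - toℕ (proj₂ x) ∣
  dist-from-bottom c (x₁ , x₂) =
    cong (_⊔ ∣ toℕ c - toℕ x₂ ∣) (trans (cong ∣_- toℕ x₁ ∣ (toℕ-fromℕ H)) (m≤n⇒∣n-m∣≡n∸m (s≤s⁻¹ (toℕ<n x₁))))

  rows-separated : ∀ {cT cB v : Fin n} {x₁ y₁ : Fin (suc H)} → (zero , cT) ∈ L → (fromℕ H , cB) ∈ L →
                   ∣ toℕ cT - toℕ v ∣ + ∣ toℕ cB - toℕ v ∣ ≤ H → toℕ x₁ < toℕ y₁ →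
                   Any (λ s → dist s (x₁ , v) ≢ dist s (y₁ , v)) L
  rows-separated {_} {cB} {v} {x₁} {y₁} top∈L bottom∈L budget x₁<y₁
    with row-separation x₁<y₁ (s≤s⁻¹ (toℕ<n y₁)) budget
  ... | inj₁ by-top    = lose top∈L by-top
  ... | inj₂ by-bottom = lose bottom∈L λ eq →
          by-bottom (trans (sym (dist-from-bottom cB (x₁ , v))) (trans eq (dist-from-bottom cB (y₁ , v))))

  columns-separated : ∀ {c₀ c₁ c₂ x₂ y₂ : Fin n} {x₁ y₁ : Fin (suc H)} →
    (zero , c₀) ∈ L → (fromℕ H , c₁) ∈ L → (zero , c₂) ∈ L →
    toℕ c₀ ≡ 0 → toℕ c₁ ≡ H → H < toℕ c₂ → toℕ x₂ < toℕ y₂ →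
    Any (λ s → dist s (x₁ , x₂) ≢ dist s (y₁ , y₂)) L
  columns-separated {c₀} {c₁} {c₂} {x₂} {y₂} {x₁} {y₁} origin∈L corner∈L far∈L c₀≡0 c₁≡H H<c₂ x₂<y₂
    with dist (zero , c₀) (x₁ , x₂) ℕ.≟ dist (zero , c₀) (y₁ , y₂)
       | dist (fromℕ H , c₁) (x₁ , x₂) ℕ.≟ dist (fromℕ H , c₁) (y₁ , y₂)
  ... | no separated | _            = lose origin∈L separated
  ... | yes _        | no separated = lose corner∈L separated
  ... | yes from-origin | yes from-corner with corner-distances⇒transposed
          (s≤s⁻¹ (toℕ<n x₁)) (s≤s⁻¹ (toℕ<n y₁)) x₂<y₂
          (subst (λ c → toℕ x₁ ⊔ ∣ c - toℕ x₂ ∣ ≡ toℕ y₁ ⊔ ∣ c - toℕ y₂ ∣) c₀≡0 from-origin)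
          (subst₂ (λ r c → ∣ r - toℕ x₁ ∣ ⊔ ∣ c - toℕ x₂ ∣ ≡ ∣ r - toℕ y₁ ∣ ⊔ ∣ c - toℕ y₂ ∣)
                  (toℕ-fromℕ H) c₁≡H from-corner)
  ... | x₂<x₁ , y₁≡x₂ , y₂≡x₁ = lose far∈L λ from-far →
          transposed-separated x₂<x₁ (≤-<-trans (s≤s⁻¹ (toℕ<n x₁)) H<c₂)
            (trans from-far (cong₂ (λ u w → u ⊔ ∣ toℕ c₂ - w ∣) y₁≡x₂ y₂≡x₁))

m<[1+m/n]*n : ∀ m n .{{_ : NonZero n}} → m < suc (m / n) * n
m<[1+m/n]*n m n = begin-strict
  m                 ≡⟨ m≡m%n+[m/n]*n m n ⟩
  m % n + m / n * n <⟨ +-monoˡ-< (m / n * n) (m%n<n m n) ⟩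
  n + m / n * n     ∎
  where open ≤-Reasoning

[m+n]/n≡1+m/n : ∀ m n .{{_ : NonZero n}} → (m + n) / n ≡ suc (m / n)
[m+n]/n≡1+m/n m n = trans (m/n≡1+[m∸n]/n (m≤n+m n m)) (cong (λ t → suc (t / n)) (m+n∸n≡m m n))

-- With H = n₁ - 1 and columns 0, …, N, landmark t (t ≤ q = ⌈N / H⌉) sits at column min(t H, N),
-- alternately on rows 0 and H.
module Zigzag (k N : ℕ) (H<N : suc k < N) where

  H : ℕ
  H = suc k

  q : ℕ
  q = (N + k) / H

  N≤q*H : N ≤ q * H
  N≤q*H = +-cancelʳ-≤ k N (q * H) (begin
    N + k     ≤⟨ s≤s⁻¹ (m<[1+m/n]*n (N + k) H) ⟩
    k + q * H ≡⟨ +-comm k (q * H) ⟩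
    q * H + k ∎)
    where open ≤-Reasoning

  2≤q : 2 ≤ q
  2≤q = ≮⇒≥ λ q<2 → <⇒≱ H<N (begin
    N     ≤⟨ N≤q*H ⟩
    q * H ≤⟨ *-monoˡ-≤ H (s≤s⁻¹ q<2) ⟩
    1 * H ≡⟨ *-identityˡ H ⟩
    H     ∎)
    where open ≤-Reasoning

  column : ℕ → Fin (suc N)
  column t = fromℕ< (s≤s (m⊓n≤n (t * H) N))

  toℕ-column : ∀ t → toℕ (column t) ≡ t * H ⊓ N
  toℕ-column t = toℕ-fromℕ< (s≤s (m⊓n≤n (t * H) N))

  onTop : ℕ → Bool
  onTop zero    = true
  onTop (suc t) = not (onTop t)

  row : Bool → Fin (suc H)
  row true  = zero
  row false = fromℕ H

  landmark : ℕ → Fin (suc H) × Fin (suc N)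
  landmark t = row (onTop t) , column t

  landmarks : List (Fin (suc H) × Fin (suc N))
  landmarks = applyUpTo landmark (suc q)

  length-landmarks : length landmarks ≡ suc q
  length-landmarks = length-applyUpTo landmark (suc q)

  landmark∈ : ∀ {t} → t ≤ q → landmark t ∈ landmarks
  landmark∈ t≤q = ∈-applyUpTo⁺ landmark (s≤s t≤q)

  between-landmarks : ∀ (v : Fin (suc N)) → ∃[ t ] (suc t ≤ q × toℕ (column t) ≤ toℕ v ×
                      toℕ v ≤ toℕ (column (suc t)) × toℕ (column (suc t)) ≤ H + toℕ (column t))
  between-landmarks v = t , t<q , ct≤v , v≤ct′ , ct′≤H+ct
    where
    t = pred (toℕ v) / H
    v≤N : toℕ v ≤ N
    v≤N = s≤s⁻¹ (toℕ<n v)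
    t*H≤v : t * H ≤ toℕ v
    t*H≤v = ≤-trans (m/n*n≤m (pred (toℕ v)) H) pred[n]≤n
    t<q : t < q
    t<q = m<n*o⇒m/o<n (<-≤-trans (m≤pred[n]⇒suc[m]≤n {{>-nonZero (<-trans z<s H<N)}} (pred-mono-≤ v≤N)) N≤q*H)
    v≤[1+t]*H : toℕ v ≤ suc t * H
    v≤[1+t]*H = pred<⇒≤ (m<[1+m/n]*n (pred (toℕ v)) H)
      where
      pred<⇒≤ : ∀ {m n} → pred m < n → m ≤ n
      pred<⇒≤ {zero}  _   = z≤n
      pred<⇒≤ {suc m} m<n = m<n
    ct≡t*H : toℕ (column t) ≡ t * H
    ct≡t*H = trans (toℕ-column t) (m≤n⇒m⊓n≡m (≤-trans t*H≤v v≤N))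
    ct≤v : toℕ (column t) ≤ toℕ v
    ct≤v = subst (_≤ toℕ v) (sym ct≡t*H) t*H≤v
    v≤ct′ : toℕ v ≤ toℕ (column (suc t))
    v≤ct′ = subst (toℕ v ≤_) (sym (toℕ-column (suc t))) (⊓-glb v≤[1+t]*H v≤N)
    ct′≤H+ct : toℕ (column (suc t)) ≤ H + toℕ (column t)
    ct′≤H+ct = subst₂ _≤_ (sym (toℕ-column (suc t))) (cong (H +_) (sym ct≡t*H)) (m⊓n≤m (H + t * H) N)

  rows-resolved : ∀ {x₁ y₁ : Fin (suc H)} (v : Fin (suc N)) → toℕ x₁ < toℕ y₁ →
                  Any (λ s → dist s (x₁ , v) ≢ dist s (y₁ , v)) landmarks
  rows-resolved {x₁} {y₁} v x₁<y₁ with between-landmarks v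
  ... | t , t<q , ct≤v , v≤ct′ , ct′≤H+ct = separate (onTop t) (landmark∈ (<⇒≤ t<q)) (landmark∈ t<q)
    where
    span : ∣ toℕ (column t) - toℕ v ∣ + ∣ toℕ (column (suc t)) - toℕ v ∣ ≤ H
    span = ∣-∣+∣-∣≤span ct≤v v≤ct′ ct′≤H+ct
    separate : ∀ b → (row b , column t) ∈ landmarks → (row (not b) , column (suc t)) ∈ landmarks →
               Any (λ s → dist s (x₁ , v) ≢ dist s (y₁ , v)) landmarks
    separate true  top∈ bottom∈ = rows-separated top∈ bottom∈ span x₁<y₁
    separate false bottom∈ top∈ =
      rows-separated top∈ bottom∈ (subst (_≤ H) (+-comm ∣ toℕ (column t) - toℕ v ∣ _) span) x₁<y₁

  columns-resolved : ∀ {x₁ y₁ : Fin (suc H)} {x₂ y₂ : Fin (suc N)} → toℕ x₂ < toℕ y₂ →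
                     Any (λ s → dist s (x₁ , x₂) ≢ dist s (y₁ , y₂)) landmarks
  columns-resolved = columns-separated (landmark∈ z≤n) (landmark∈ (≤-trans (n≤1+n 1) 2≤q)) (landmark∈ 2≤q)
                                       (toℕ-column 0) column₁≡H H<column₂
    where
    column₁≡H : toℕ (column 1) ≡ H
    column₁≡H = trans (toℕ-column 1) (trans (cong (_⊓ N) (*-identityˡ H)) (m≤n⇒m⊓n≡m (<⇒≤ H<N)))
    H<column₂ : H < toℕ (column 2)
    H<column₂ = subst (H <_) (sym (toℕ-column 2)) (⊓-glb (m<m+n H z<s) H<N)

  landmarks-resolve : Resolves dist landmarks
  landmarks-resolve (x₁ , x₂) (y₁ , y₂) x≢y with Fin.<-cmp x₂ y₂
  ... | tri< x₂<y₂ _ _ = columns-resolved x₂<y₂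
  ... | tri> _ _ y₂<x₂ = Any.map ≢-sym (columns-resolved y₂<x₂)
  ... | tri≈ _ refl _ with Fin.<-cmp x₁ y₁
  ...   | tri< x₁<y₁ _ _ = rows-resolved x₂ x₁<y₁
  ...   | tri> _ _ y₁<x₁ = Any.map ≢-sym (rows-resolved x₂ y₁<x₁)
  ...   | tri≈ _ refl _  = contradiction refl x≢y

grid-any? : ∀ {m n} {P : Fin m × Fin n → Set} → Decidable P → Dec (∃ P)
grid-any? P? = map′ (λ { (a , b , p) → (a , b) , p }) (λ { ((a , b) , p) → a , b , p })
                  (Fin.any? λ a → Fin.any? λ b → P? (a , b))

theorem5 : ∀ (n₁ n₂ : ℕ) → 2 ≤ n₁ → n₁ < n₂ →
    ∃[ d ] (IsMetricDim (Path n₁ ⊠ Path n₂) d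
            × floorDivPred (n₁ + n₂ ∸ 2) n₁ ≤ d
            × d ≤ ceilDivPred (n₁ + n₂ ∸ 2) n₁)
theorem5 (suc (suc k)) (suc N) (s≤s (s≤s z≤n)) (s≤s H<N) =
  let dim , isDim , dim≤|landmarks| =
        metricDim≤ landmarks (Resolves⇒MetricGenerator grid-IsDist landmarks-resolve)
  in dim , isDim , lower-bound isDim , subst (dim ≤_) |landmarks|≡ceiling dim≤|landmarks|
  where
  open Zigzag k N H<N
  open MetricDimension (≡-dec Fin._≟_ Fin._≟_) grid-any? (Path (suc (suc k)) ⊠ Path (suc N)) dist grid-IsDist
  lower-bound : ∀ {d} → IsMetricDim (Path (suc (suc k)) ⊠ Path (suc N)) d → (k + suc N) / suc k ≤ d
  lower-bound ((S , _ , refl , gen) , _) = resolving⇒[k+n]/[1+k]≤|S| S (MetricGenerator⇒Resolves grid-IsDist gen)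
  |landmarks|≡ceiling : length landmarks ≡ (k + suc N + k) / suc k
  |landmarks|≡ceiling = begin
    length landmarks        ≡⟨ length-landmarks ⟩
    suc ((N + k) / suc k)   ≡⟨ [m+n]/n≡1+m/n (N + k) (suc k) ⟨
    (N + k + suc k) / suc k ≡⟨ cong (_/ suc k) (rearrange N k) ⟩
    (k + suc N + k) / suc k ∎
    where
    open ≡-Reasoning
    rearrange : ∀ N k → N + k + suc k ≡ k + suc N + k
    rearrange = solve-∀
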